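{- Let $\Pi=\Gamma_d\circ\Gamma_s$ on $\Sigma^*$. For every $U\in\Sigma^{*}$: (1) $\Pi(U1)=\overline{\Pi(U)}\,2$; (2) $\Pi(U2)=\Pi(\Pi(U))\,1$; (3) $\Gamma_{s}(UX)=\Pi\big(\Gamma_{s}(U)\,\overline{X}\big)$ for every $X\in\Sigma$; (4) $\Gamma_{d}(U)=\Pi(\Gamma_{s}(U))$.
   Context: Let $\Sigma=\{1,2\}$, $\Sigma_0=\{0,1,2\}$. The complement $\overline{w}$ of a word over $\Sigma$ exchanges $1$ and $2$ (so for a letter $X\in\Sigma$, $\overline{X}$ is the other letter); $w[i]$ is the $(i+1)$-th letter, $\tilde w$ the reversal; juxtaposition denotes concatenation. For $w=x_1^{i_1}\cdots x_n^{i_n}$ over $\Sigma$ (maximal runs), $\Delta(w)=i_1\cdots i_n$. The derivative: $D(\epsilon)=\epsilon$, otherwise (when $\Delta(w)$ is over $\Sigma$) $D(w)$ is $\Delta(w)$ with its first symbol deleted if it is $1$ and its last symbol deleted if it is $1$. $\mathbf{C}^{\infty}$ is the set of words with $D^j(w)$ defined for all $j$. Height: least $k$ with $D^k(w)=\epsilon$; root: $D^{k-1}(w)$; single-/double-rooted if the root has length one/two. A primitive of $w$ is $w'$ with $D(w')=w$. $w\in\mathbf{C}^{\infty}$ of height $k>1$ is minimal if for each $0\le j\le k-2$, $D^j(w)$ is a primitive of $D^{j+1}(w)$ of minimal length among all its primitives; words of height $1$ are minimal. Left frontier of $w$ of height $k>0$: the word $\Psi(w)$ of length $k$ with $\Psi(w)[0]=w[0]$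 and for $0<i<k$, $\Psi(w)[i]=0$ if $D^i(w)[0]=2$ and $D^{i-1}(w)[0]\ne D^{i-1}(w)[1]$, else $\Psi(w)[i]=D^i(w)[0]$; $\Psi(\epsilon)=\epsilon$. Right frontier: $\Psi(\tilde w)$. Each $U\in\Sigma^*$ is the left frontier of a unique single-rooted minimal word and of a unique double-rooted minimal word; $\Gamma_s(U)$ (resp. $\Gamma_d(U)$) is the right frontier of the single-rooted (resp. double-rooted) minimal word with left frontier $U$, with $\Gamma_s(\epsilon)=\Gamma_d(\epsilon)=\epsilon$. Both are maps $\Sigma^*\to\Sigma^*$. -}

module Defs where

open import Data.Nat using (ℕ; zero; suc; _<_; _≤_)
open import Data.Bool using (Bool; true; false; if_then_else_)
open import Data.List using (List; []; _∷_; map; length; reverse; upTo; _++_)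
open import Data.Maybe using (Maybe; just; nothing; _>>=_)
open import Data.Product using (Σ; ∃; _×_; _,_)
open import Relation.Binary.PropositionalEquality using (_≡_)
open import Relation.Nullary using (¬_)

data Sym : Set where
  s1 s2 : Sym

data Sym0 : Set where
  z0 z1 z2 : Sym0

embed : Sym → Sym0
embed s1 = z1
embed s2 = z2

Word : Set
Word = List Sym

flip : Sym → Sym
flip s1 = s2
flip s2 = s1

comp : Word → Word
comp = map flip

_==_ : Sym → Sym → Bool
s1 == s1 = true
s2 == s2 = true
_  == _  = false

-- Δ(w) as a list of natural numbers: lengths of the maximal runs of w
runsFrom : Sym → ℕ → Word → List ℕ
runsFrom x n []       = n ∷ []
runsFrom x n (y ∷ ys) = if x == y then runsFrom x (suc n) ys else (n ∷ runsFrom y 1 ys)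

runs : Word → List ℕ
runs []       = []
runs (x ∷ xs) = runsFrom x 1 xs

toSym : ℕ → Maybe Sym
toSym 1 = just s1
toSym 2 = just s2
toSym _ = nothing

mapMaybe' : List ℕ → Maybe Word
mapMaybe' []       = just []
mapMaybe' (n ∷ ns) = toSym n >>= λ x → mapMaybe' ns >>= λ xs → just (x ∷ xs)

Δ : Word → Maybe Word
Δ w = mapMaybe' (runs w)

dropFirst1 : Word → Word
dropFirst1 (s1 ∷ xs) = xs
dropFirst1 xs        = xs

dropLast1 : Word → Word
dropLast1 xs = reverse (dropFirst1 (reverse xs))

D : Word → Maybe Word
D []      = just []
D (x ∷ w) = Δ (x ∷ w) >>= λ v → just (dropLast1 (dropFirst1 v))

Dⁿ : ℕ → Word → Maybe Word
Dⁿ zero    w = just w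
Dⁿ (suc j) w = Dⁿ j w >>= D

InC∞ : Word → Set
InC∞ w = ∀ j → ∃ λ v → Dⁿ j w ≡ just v

Height : Word → ℕ → Set
Height w k = Dⁿ k w ≡ just [] × (∀ j → j < k → ¬ (Dⁿ j w ≡ just []))

IsPrimitive : Word → Word → Set
IsPrimitive w' w = D w' ≡ just w

Minimal : Word → Set
Minimal w = InC∞ w × (∀ k → Height w k → ∀ j → suc (suc j) ≤ k →
  ∀ v u → Dⁿ j w ≡ just v → Dⁿ (suc j) w ≡ just u →
  ∀ p → IsPrimitive p u → length v ≤ length p)

SingleRooted : Word → Set
SingleRooted w = Σ ℕ λ k → Σ Word λ r → Height w (suc k) × Dⁿ k w ≡ just r × length r ≡ 1

DoubleRooted : Word → Set
DoubleRooted w = Σ ℕ λ k → Σ Word λ r → Height w (suc k) × Dⁿ k w ≡ just r × length r ≡ 2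

head0 : Word → Maybe Sym
head0 []      = nothing
head0 (x ∷ _) = just x

firstTwoDiffer : Word → Maybe Bool
firstTwoDiffer (a ∷ b ∷ _) = just (if a == b then false else true)
firstTwoDiffer _           = nothing

-- the i-th letter of the left frontier Ψ(w)
psiAt : Word → ℕ → Maybe Sym0
psiAt w zero    = head0 w >>= λ a → just (embed a)
psiAt w (suc i) =
  Dⁿ i w >>= λ v → D v >>= λ u → head0 u >>= λ a →
  firstTwoDiffer v >>= λ d →
  just (if (a == s2) then (if d then z0 else embed a) else embed a)

sequenceM : List (Maybe Sym0) → Maybe (List Sym0)
sequenceM []       = just []
sequenceM (m ∷ ms) = m >>= λ x → sequenceM ms >>= λ xs → just (x ∷ xs)

Ψ : Word → ℕ → Maybe (List Sym0)
Ψ w k = sequenceM (map (psiAt w) (upTo k))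

LeftFrontier : Word → List Sym0 → Set
LeftFrontier w U = Σ ℕ λ k → Height w k × Ψ w k ≡ just U

RightFrontier : Word → List Sym0 → Set
RightFrontier w V = LeftFrontier (reverse w) V

-- g is Γ_s : Γ_s(ε)=ε and Γ_s(U) is the right frontier of the
-- single-rooted minimal word with left frontier U
IsΓs : (Word → Word) → Set
IsΓs g = g [] ≡ [] × (∀ U w → Minimal w → SingleRooted w →
  LeftFrontier w (map embed U) → RightFrontier w (map embed (g U)))

IsΓd : (Word → Word) → Set
IsΓd g = g [] ≡ [] × (∀ U w → Minimal w → DoubleRooted w →
  LeftFrontier w (map embed U) → RightFrontier w (map embed (g U)))

-- Every non-empty word u has a shortest primitive starting with a prescribed letter y,
-- namely  prim y u : the word starting with y whose run lengths are u, padded with a 1 at each end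
-- where u itself has a 1.  Iterating, a word Y and a root t (D t = ε) give the "tower"
-- prim y₁ (prim y₂ (⋯ t)), which is minimal with left frontier Y t[0]; its right frontier is
-- rightEdge Y t followed by the last letter of t.  Since a left frontier determines the minimal word,
--   Γs (U x) = (rightEdge U x) x       and       Γd (U x) = (rightEdge U (x x̄)) x̄.
-- The theorem is thereby reduced to identities between right edges of towers.  These follow from
-- three structural facts: (i) reversing a tower gives the tower over the reversed root whose letters
-- are the right edge (so rightEdge is an involution); (ii) changing the last letter of the root
-- complements the right edge; (iii) if every level of one tower is a fixed word prepended to the
-- corresponding level of another, this persists when the root of the second is replaced by any root
-- with the same first letter, and then both have the same right edge.

module Submission where

open import Defs
open import Data.List using (List; []; _∷_; _++_)
open import Data.Product using (_×_)
open import Relation.Binary.PropositionalEquality using (_≡_)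

open import Data.Bool using (true; false; if_then_else_)
open import Data.Empty using (⊥-elim)
open import Data.List using (_∷ʳ_; reverse; length; map; foldr; zipWith; upTo; applyUpTo; initLast; _∷ʳ′_)
open import Data.List.Properties
  using (++-assoc; ++-identityʳ; reverse-++; reverse-involutive; unfold-reverse; length-++; map-++;
         ∷-injective; ∷-injectiveˡ; ∷-injectiveʳ; map-applyUpTo; map-upTo; map-cong; map-injective;
         reverse-map; foldr-++)
open import Data.List.Relation.Binary.Permutation.Propositional.Properties using (↭-reverse)
open import Data.Maybe using (Maybe; just; nothing; _>>=_)
open import Data.Maybe.Properties using (just-injective)
open import Data.Nat using (ℕ; zero; suc; _+_; _≤_; _<_; z≤n; s≤s)
open import Data.Nat.ListAction using (sum)
open import Data.Nat.ListAction.Properties using (sum-++; sum-↭)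
open import Data.Nat.Properties
  using (+-suc; +-comm; +-cancelʳ-≡; +-mono-≤; ≤-refl; <-cmp; suc-injective; module ≤-Reasoning)
open import Data.Product using (Σ; _,_; proj₁; proj₂)
open import Data.Sum using (_⊎_; inj₁; inj₂)
open import Function using (_∘_)
open import Relation.Binary.Definitions using (tri<; tri≈; tri>)
open import Relation.Binary.PropositionalEquality
  using (refl; sym; trans; cong; cong₂; subst; module ≡-Reasoning)
open import Relation.Nullary using (¬_)

flip-involutive : ∀ a → flip (flip a) ≡ a
flip-involutive s1 = refl
flip-involutive s2 = refl

data NonEmpty : Word → Set where
  ne : ∀ x xs → NonEmpty (x ∷ xs)

nonEmpty-++ : ∀ xs ys → NonEmpty xs → NonEmpty (xs ++ ys)
nonEmpty-++ (x ∷ xs) ys _ = ne x (xs ++ ys)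

nonEmpty-∷ʳ : ∀ xs x → NonEmpty (xs ∷ʳ x)
nonEmpty-∷ʳ []       x = ne x []
nonEmpty-∷ʳ (y ∷ xs) x = ne y (xs ∷ʳ x)

nonEmpty-reverse : ∀ xs → NonEmpty xs → NonEmpty (reverse xs)
nonEmpty-reverse (x ∷ xs) _ = subst NonEmpty (sym (unfold-reverse x xs)) (nonEmpty-∷ʳ (reverse xs) x)

nonEmpty≢ε : ∀ {w} → NonEmpty w → ¬ (w ≡ [])
nonEmpty≢ε (ne x xs) ()

-- The first and the last letter of a word (their value on ε is never used).
firstLetter : Word → Sym
firstLetter []      = s1
firstLetter (x ∷ _) = x

lastLetter : Word → Sym
lastLetter []          = s1
lastLetter (x ∷ [])    = x
lastLetter (_ ∷ y ∷ w) = lastLetter (y ∷ w)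

lastLetter-++ : ∀ xs ys → NonEmpty ys → lastLetter (xs ++ ys) ≡ lastLetter ys
lastLetter-++ []             ys       _ = refl
lastLetter-++ (x ∷ [])       (y ∷ ys) _ = refl
lastLetter-++ (x ∷ x′ ∷ xs)  ys       n = lastLetter-++ (x′ ∷ xs) ys n

lastLetter-∷ʳ : ∀ xs x → lastLetter (xs ∷ʳ x) ≡ x
lastLetter-∷ʳ xs x = lastLetter-++ xs (x ∷ []) (ne x [])

lastLetter-reverse : ∀ xs → NonEmpty xs → lastLetter (reverse xs) ≡ firstLetter xs
lastLetter-reverse (x ∷ xs) _ = trans (cong lastLetter (unfold-reverse x xs)) (lastLetter-∷ʳ (reverse xs) x)

dropLast : Word → Word
dropLast []          = []
dropLast (_ ∷ [])    = []
dropLast (x ∷ y ∷ w) = x ∷ dropLast (y ∷ w)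

dropLast-∷ʳ-lastLetter : ∀ w → NonEmpty w → w ≡ dropLast w ∷ʳ lastLetter w
dropLast-∷ʳ-lastLetter (x ∷ [])    _ = refl
dropLast-∷ʳ-lastLetter (x ∷ y ∷ w) _ = cong (x ∷_) (dropLast-∷ʳ-lastLetter (y ∷ w) (ne y w))

++-cancel-prefix : ∀ (A B : Word) {X Y} → length A ≡ length B → A ++ X ≡ B ++ Y → A ≡ B × X ≡ Y
++-cancel-prefix []      []      _  eq = refl , eq
++-cancel-prefix []      (_ ∷ _) () _
++-cancel-prefix (_ ∷ _) []      () _
++-cancel-prefix (a ∷ A) (b ∷ B) l eq with ∷-injective eq
... | refl , eq′ with ++-cancel-prefix A B (suc-injective l) eq′
...   | refl , X≡Y = refl , X≡Y

++-cancel-suffix : ∀ (A B : Word) {X Y} → length X ≡ length Y → A ++ X ≡ B ++ Y → A ≡ B × X ≡ Y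
++-cancel-suffix A B {X} {Y} lX≡lY eq = ++-cancel-prefix A B lA≡lB eq
  where
  open ≡-Reasoning
  lA≡lB : length A ≡ length B
  lA≡lB = +-cancelʳ-≡ (length X) (length A) (length B) (begin
    length A + length X  ≡⟨ sym (length-++ A) ⟩
    length (A ++ X)      ≡⟨ cong length eq ⟩
    length (B ++ Y)      ≡⟨ length-++ B ⟩
    length B + length Y  ≡⟨ cong (length B +_) (sym lX≡lY) ⟩
    length B + length X  ∎)

-- Words given by their runs

block : Sym → Sym → Word
block a s1 = a ∷ []
block a s2 = a ∷ a ∷ []

fromRuns : Sym → Word → Word
fromRuns a []      = []
fromRuns a (c ∷ r) = block a c ++ fromRuns (flip a) r

afterRuns : Sym → Word → Sym
afterRuns a []      = a
afterRuns a (_ ∷ r) = afterRuns (flip a) r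

value : Sym → ℕ
value s1 = 1
value s2 = 2

weight : Word → ℕ
weight w = sum (map value w)

weight-++ : ∀ xs ys → weight (xs ++ ys) ≡ weight xs + weight ys
weight-++ xs ys = trans (cong sum (map-++ value xs ys)) (sum-++ (map value xs) (map value ys))

weight-reverse : ∀ w → weight (reverse w) ≡ weight w
weight-reverse w = trans (cong sum (reverse-map value w)) (sum-↭ (↭-reverse (map value w)))

length-fromRuns : ∀ a r → length (fromRuns a r) ≡ weight r
length-fromRuns a []        = refl
length-fromRuns a (s1 ∷ r) = cong suc (length-fromRuns (flip a) r)
length-fromRuns a (s2 ∷ r) = cong (suc ∘ suc) (length-fromRuns (flip a) r)

fromRuns-nonEmpty : ∀ a r → NonEmpty r → NonEmpty (fromRuns a r)
fromRuns-nonEmpty a (s1 ∷ r) _ = ne a _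
fromRuns-nonEmpty a (s2 ∷ r) _ = ne a _

fromRuns-++ : ∀ a xs ys → fromRuns a (xs ++ ys) ≡ fromRuns a xs ++ fromRuns (afterRuns a xs) ys
fromRuns-++ a []       ys = refl
fromRuns-++ a (c ∷ xs) ys =
  trans (cong (block a c ++_) (fromRuns-++ (flip a) xs ys)) (sym (++-assoc (block a c) (fromRuns (flip a) xs) _))

afterRuns-++ : ∀ a xs ys → afterRuns a (xs ++ ys) ≡ afterRuns (afterRuns a xs) ys
afterRuns-++ a []       ys = refl
afterRuns-++ a (_ ∷ xs) ys = afterRuns-++ (flip a) xs ys

afterRuns-flip : ∀ a r → afterRuns (flip a) r ≡ flip (afterRuns a r)
afterRuns-flip a []      = refl
afterRuns-flip a (_ ∷ r) = afterRuns-flip (flip a) r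

-- afterRuns only depends on the parity of the number of runs.
afterRuns-reverse : ∀ a r → afterRuns a (reverse r) ≡ afterRuns a r
afterRuns-reverse a []      = refl
afterRuns-reverse a (c ∷ r) = begin
  afterRuns a (reverse (c ∷ r))           ≡⟨ cong (afterRuns a) (unfold-reverse c r) ⟩
  afterRuns a (reverse r ∷ʳ c)            ≡⟨ afterRuns-++ a (reverse r) (c ∷ []) ⟩
  flip (afterRuns a (reverse r))          ≡⟨ cong flip (afterRuns-reverse a r) ⟩
  flip (afterRuns a r)                    ≡⟨ sym (afterRuns-flip a r) ⟩
  afterRuns a (c ∷ r)                     ∎
  where open ≡-Reasoning

afterRuns-twice : ∀ a r → afterRuns (afterRuns a r) r ≡ a
afterRuns-twice a []      = refl
afterRuns-twice a (c ∷ r) = begin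
  afterRuns (flip (afterRuns (flip a) r)) r   ≡⟨ cong (λ b → afterRuns (flip b) r) (afterRuns-flip a r) ⟩
  afterRuns (flip (flip (afterRuns a r))) r   ≡⟨ cong (λ b → afterRuns b r) (flip-involutive _) ⟩
  afterRuns (afterRuns a r) r                 ≡⟨ afterRuns-twice a r ⟩
  a                                           ∎
  where open ≡-Reasoning

-- Read backwards, the runs r end with the letter a, so after them comes flip a.
afterRuns-back : ∀ a r → afterRuns (flip (afterRuns a r)) (reverse r) ≡ flip a
afterRuns-back a r = begin
  afterRuns (flip (afterRuns a r)) (reverse r)  ≡⟨ afterRuns-reverse _ r ⟩
  afterRuns (flip (afterRuns a r)) r            ≡⟨ afterRuns-flip _ r ⟩
  flip (afterRuns (afterRuns a r) r)            ≡⟨ cong flip (afterRuns-twice a r) ⟩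
  flip a                                        ∎
  where open ≡-Reasoning

lastLetter-fromRuns : ∀ a r → NonEmpty r → lastLetter (fromRuns a r) ≡ flip (afterRuns a r)
lastLetter-fromRuns a (s1 ∷ [])    _ = sym (flip-involutive a)
lastLetter-fromRuns a (s2 ∷ [])    _ = sym (flip-involutive a)
lastLetter-fromRuns a (c ∷ d ∷ r) _ =
  trans (lastLetter-++ (block a c) _ (fromRuns-nonEmpty (flip a) (d ∷ r) (ne d r)))
        (lastLetter-fromRuns (flip a) (d ∷ r) (ne d r))

fromRuns-split-last : ∀ a r → NonEmpty r → fromRuns a r ≡ dropLast (fromRuns a r) ∷ʳ flip (afterRuns a r)
fromRuns-split-last a r n =
  trans (dropLast-∷ʳ-lastLetter _ (fromRuns-nonEmpty a r n))
        (cong (dropLast (fromRuns a r) ∷ʳ_) (lastLetter-fromRuns a r n))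

reverse-fromRuns : ∀ a r → reverse (fromRuns a r) ≡ fromRuns (flip (afterRuns a r)) (reverse r)
reverse-fromRuns a []      = refl
reverse-fromRuns a (c ∷ r) = begin
  reverse (block a c ++ fromRuns (flip a) r)
    ≡⟨ reverse-++ (block a c) _ ⟩
  reverse (fromRuns (flip a) r) ++ reverse (block a c)
    ≡⟨ cong₂ _++_ (reverse-fromRuns (flip a) r) (block-reverse c) ⟩
  fromRuns b (reverse r) ++ block a c
    ≡⟨ cong (fromRuns b (reverse r) ++_) lastBlock ⟩
  fromRuns b (reverse r) ++ fromRuns (afterRuns b (reverse r)) (c ∷ [])
    ≡⟨ sym (fromRuns-++ b (reverse r) (c ∷ [])) ⟩
  fromRuns b (reverse r ∷ʳ c)
    ≡⟨ cong (fromRuns b) (sym (unfold-reverse c r)) ⟩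
  fromRuns b (reverse (c ∷ r))
    ∎
  where
  open ≡-Reasoning
  b = flip (afterRuns (flip a) r)
  block-reverse : ∀ c → reverse (block a c) ≡ block a c
  block-reverse s1 = refl
  block-reverse s2 = refl
  lastBlock : block a c ≡ fromRuns (afterRuns b (reverse r)) (c ∷ [])
  lastBlock = trans (cong (λ z → block z c) (sym (trans (afterRuns-back (flip a) r) (flip-involutive a))))
                    (sym (++-identityʳ _))

-- Shortest primitives and towers

lead1 : Word → Word
lead1 (s1 ∷ _) = s1 ∷ []
lead1 _        = []

trail1 : Word → Word
trail1 w = lead1 (reverse w)

-- Padding u with a 1 at each end where u has a 1 gives the run lengths of the shortest primitives of u:
-- a first or last run of length 1 of a primitive would be deleted by D.
lpad rpad pad : Word → Word
lpad u = lead1 u ++ u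
rpad u = u ++ trail1 u
pad  u = lead1 u ++ u ++ trail1 u

-- prim y u is the shortest primitive of u that starts with the letter y.
prim : Sym → Word → Word
prim y u = fromRuns y (pad u)

tower : Word → Word → Word
tower Y t = foldr prim t Y

rightEdge : Word → Word → Word
rightEdge []      t = []
rightEdge (y ∷ Y) t = lastLetter (prim y (tower Y t)) ∷ rightEdge Y t

-- The levels of the tower, from the top down to the root (defined so that the head is always visible).
levels lowerLevels : Word → Word → List Word
levels Y t = tower Y t ∷ lowerLevels Y t
lowerLevels []      t = []
lowerLevels (_ ∷ Y) t = levels Y t

lead1-reverse : ∀ w → reverse (lead1 w) ≡ lead1 w
lead1-reverse []       = refl
lead1-reverse (s1 ∷ _) = refl
lead1-reverse (s2 ∷ _) = refl

lead1-++ : ∀ xs ys → NonEmpty xs → lead1 (xs ++ ys) ≡ lead1 xs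
lead1-++ (s1 ∷ xs) ys _ = refl
lead1-++ (s2 ∷ xs) ys _ = refl

trail1-++ : ∀ xs ys → NonEmpty ys → trail1 (xs ++ ys) ≡ trail1 ys
trail1-++ xs ys n =
  trans (cong lead1 (reverse-++ xs ys)) (lead1-++ (reverse ys) (reverse xs) (nonEmpty-reverse ys n))

trail1-cases : ∀ w → trail1 w ≡ [] ⊎ trail1 w ≡ s1 ∷ []
trail1-cases w with reverse w
... | []     = inj₁ refl
... | s1 ∷ _ = inj₂ refl
... | s2 ∷ _ = inj₁ refl

lpad-nonEmpty : ∀ u → NonEmpty u → NonEmpty (lpad u)
lpad-nonEmpty (s1 ∷ u) _ = ne s1 _
lpad-nonEmpty (s2 ∷ u) _ = ne s2 _

pad-nonEmpty : ∀ u → NonEmpty u → NonEmpty (pad u)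
pad-nonEmpty (s1 ∷ u) _ = ne s1 _
pad-nonEmpty (s2 ∷ u) _ = ne s2 _

pad-lpad : ∀ u → pad u ≡ lpad u ++ trail1 u
pad-lpad u = sym (++-assoc (lead1 u) u (trail1 u))

pad-++ : ∀ C S → NonEmpty C → NonEmpty S → pad (C ++ S) ≡ lpad C ++ rpad S
pad-++ C S nC nS = begin
  lead1 (C ++ S) ++ (C ++ S) ++ trail1 (C ++ S)
    ≡⟨ cong₂ (λ l t → l ++ (C ++ S) ++ t) (lead1-++ C S nC) (trail1-++ C S nS) ⟩
  lead1 C ++ (C ++ S) ++ trail1 S
    ≡⟨ cong (lead1 C ++_) (++-assoc C S (trail1 S)) ⟩
  lead1 C ++ C ++ S ++ trail1 S
    ≡⟨ sym (++-assoc (lead1 C) C _) ⟩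
  (lead1 C ++ C) ++ S ++ trail1 S
    ∎
  where open ≡-Reasoning

pad-reverse : ∀ u → pad (reverse u) ≡ reverse (pad u)
pad-reverse u = begin
  lead1 (reverse u) ++ reverse u ++ lead1 (reverse (reverse u))
    ≡⟨ cong (λ v → lead1 (reverse u) ++ reverse u ++ lead1 v) (reverse-involutive u) ⟩
  lead1 (reverse u) ++ reverse u ++ lead1 u
    ≡⟨ sym (++-assoc (lead1 (reverse u)) (reverse u) (lead1 u)) ⟩
  (lead1 (reverse u) ++ reverse u) ++ lead1 u
    ≡⟨ cong₂ (λ l m → (l ++ reverse u) ++ m) (sym (lead1-reverse (reverse u))) (sym (lead1-reverse u)) ⟩
  (reverse (trail1 u) ++ reverse u) ++ reverse (lead1 u)
    ≡⟨ cong (_++ reverse (lead1 u)) (sym (reverse-++ u (trail1 u))) ⟩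
  reverse (u ++ trail1 u) ++ reverse (lead1 u)
    ≡⟨ sym (reverse-++ (lead1 u) (u ++ trail1 u)) ⟩
  reverse (lead1 u ++ u ++ trail1 u)
    ∎
  where open ≡-Reasoning

prim-nonEmpty : ∀ y u → NonEmpty u → NonEmpty (prim y u)
prim-nonEmpty y u n = fromRuns-nonEmpty y (pad u) (pad-nonEmpty u n)

firstLetter-prim : ∀ y u → NonEmpty u → firstLetter (prim y u) ≡ y
firstLetter-prim y (s1 ∷ u) _ = refl
firstLetter-prim y (s2 ∷ u) _ = refl

length-prim : ∀ a b u → length (prim a u) ≡ length (prim b u)
length-prim a b u = trans (length-fromRuns a (pad u)) (sym (length-fromRuns b (pad u)))

reverse-prim : ∀ y u → reverse (prim y u) ≡ prim (lastLetter (prim y u)) (reverse u)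
reverse-prim y []       = refl
reverse-prim y (x ∷ u)  = begin
  reverse (fromRuns y (pad (x ∷ u)))
    ≡⟨ reverse-fromRuns y (pad (x ∷ u)) ⟩
  fromRuns (flip (afterRuns y (pad (x ∷ u)))) (reverse (pad (x ∷ u)))
    ≡⟨ cong₂ fromRuns (sym (lastLetter-fromRuns y _ (pad-nonEmpty (x ∷ u) (ne x u))))
                      (sym (pad-reverse (x ∷ u))) ⟩
  fromRuns (lastLetter (prim y (x ∷ u))) (pad (reverse (x ∷ u)))
    ∎
  where open ≡-Reasoning

tower-nonEmpty : ∀ Y t → NonEmpty t → NonEmpty (tower Y t)
tower-nonEmpty []      t n = n
tower-nonEmpty (y ∷ Y) t n = prim-nonEmpty y (tower Y t) (tower-nonEmpty Y t n)

tower-firstLetter : ∀ Y {s s′} → NonEmpty s → NonEmpty s′ → firstLetter s ≡ firstLetter s′ →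
                    firstLetter (tower Y s) ≡ firstLetter (tower Y s′)
tower-firstLetter []      _  _   h = h
tower-firstLetter (y ∷ Y) ns ns′ _ =
  trans (firstLetter-prim y _ (tower-nonEmpty Y _ ns)) (sym (firstLetter-prim y _ (tower-nonEmpty Y _ ns′)))

tower-∷ʳ : ∀ Y y t → tower (Y ∷ʳ y) t ≡ tower Y (prim y t)
tower-∷ʳ Y y t = foldr-++ prim t Y (y ∷ [])

rightEdge-∷ʳ : ∀ Y y t → rightEdge (Y ∷ʳ y) t ≡ rightEdge Y (prim y t) ∷ʳ lastLetter (prim y t)
rightEdge-∷ʳ []      y t = refl
rightEdge-∷ʳ (z ∷ Y) y t =
  cong₂ _∷_ (cong (λ w → lastLetter (prim z w)) (tower-∷ʳ Y y t)) (rightEdge-∷ʳ Y y t)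

length-rightEdge : ∀ Y t → length (rightEdge Y t) ≡ length Y
length-rightEdge []      t = refl
length-rightEdge (y ∷ Y) t = cong suc (length-rightEdge Y t)

reverse-levels : ∀ Y t → map reverse (levels Y t) ≡ levels (rightEdge Y t) (reverse t)
reverse-levels []      t = refl
reverse-levels (y ∷ Y) t = cong₂ _∷_ top below
  where
  below = reverse-levels Y t
  top : reverse (prim y (tower Y t)) ≡ prim (lastLetter (prim y (tower Y t))) (tower (rightEdge Y t) (reverse t))
  top = trans (reverse-prim y (tower Y t)) (cong (prim _) (∷-injectiveˡ below))

reverse-tower : ∀ Y t → reverse (tower Y t) ≡ tower (rightEdge Y t) (reverse t)
reverse-tower Y t = ∷-injectiveˡ (reverse-levels Y t)

-- Reading a tower from the other side twice gives it back: rightEdge is an involution.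
rightEdge-involutive : ∀ Y t → NonEmpty t → rightEdge (rightEdge Y t) (reverse t) ≡ Y
rightEdge-involutive []      t n = refl
rightEdge-involutive (y ∷ Y) t n = cong₂ _∷_ returns (rightEdge-involutive Y t n)
  where
  open ≡-Reasoning
  ℓ = lastLetter (prim y (tower Y t))
  returns : lastLetter (prim ℓ (tower (rightEdge Y t) (reverse t))) ≡ y
  returns = begin
    lastLetter (prim ℓ (tower (rightEdge Y t) (reverse t)))
      ≡⟨ cong (lastLetter ∘ prim ℓ) (sym (reverse-tower Y t)) ⟩
    lastLetter (prim ℓ (reverse (tower Y t)))
      ≡⟨ cong lastLetter (sym (reverse-prim y (tower Y t))) ⟩
    lastLetter (reverse (prim y (tower Y t)))
      ≡⟨ lastLetter-reverse _ (prim-nonEmpty y _ (tower-nonEmpty Y t n)) ⟩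
    firstLetter (prim y (tower Y t))
      ≡⟨ firstLetter-prim y _ (tower-nonEmpty Y t n) ⟩
    y ∎

trim : Word → Word
trim v = dropLast1 (dropFirst1 v)

D-nonEmpty : ∀ w → NonEmpty w → D w ≡ (Δ w >>= λ v → just (trim v))
D-nonEmpty (x ∷ w) _ = refl

runsFrom-fromRuns : ∀ a n r → runsFrom a n (fromRuns (flip a) r) ≡ n ∷ map value r
runsFrom-fromRuns s1 n []       = refl
runsFrom-fromRuns s2 n []       = refl
runsFrom-fromRuns s1 n (s1 ∷ r) = cong (n ∷_) (runsFrom-fromRuns s2 1 r)
runsFrom-fromRuns s2 n (s1 ∷ r) = cong (n ∷_) (runsFrom-fromRuns s1 1 r)
runsFrom-fromRuns s1 n (s2 ∷ r) = cong (n ∷_) (runsFrom-fromRuns s2 2 r)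
runsFrom-fromRuns s2 n (s2 ∷ r) = cong (n ∷_) (runsFrom-fromRuns s1 2 r)

runs-fromRuns : ∀ a c r → runs (fromRuns a (c ∷ r)) ≡ map value (c ∷ r)
runs-fromRuns a  s1 r = runsFrom-fromRuns a 1 r
runs-fromRuns s1 s2 r = runsFrom-fromRuns s1 2 r
runs-fromRuns s2 s2 r = runsFrom-fromRuns s2 2 r

mapMaybe'-value : ∀ r → mapMaybe' (map value r) ≡ just r
mapMaybe'-value []       = refl
mapMaybe'-value (s1 ∷ r) = cong (_>>= λ xs → just (s1 ∷ xs)) (mapMaybe'-value r)
mapMaybe'-value (s2 ∷ r) = cong (_>>= λ xs → just (s2 ∷ xs)) (mapMaybe'-value r)

mapMaybe'-sound : ∀ ns v → mapMaybe' ns ≡ just v → map value v ≡ ns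
mapMaybe'-sound []                       v refl = refl
mapMaybe'-sound (0 ∷ ns)                 v ()
mapMaybe'-sound (suc (suc (suc _)) ∷ ns) v ()
mapMaybe'-sound (1 ∷ ns) v e with mapMaybe' ns in rest
mapMaybe'-sound (1 ∷ ns) v refl | just xs = cong (1 ∷_) (mapMaybe'-sound ns xs rest)
mapMaybe'-sound (2 ∷ ns) v e with mapMaybe' ns in rest
mapMaybe'-sound (2 ∷ ns) v refl | just xs = cong (2 ∷_) (mapMaybe'-sound ns xs rest)

D-fromRuns : ∀ a r → NonEmpty r → D (fromRuns a r) ≡ just (trim r)
D-fromRuns a (c ∷ r) n = begin
  D (fromRuns a (c ∷ r))
    ≡⟨ D-nonEmpty _ (fromRuns-nonEmpty a (c ∷ r) n) ⟩
  (mapMaybe' (runs (fromRuns a (c ∷ r))) >>= λ v → just (trim v))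
    ≡⟨ cong (λ ns → mapMaybe' ns >>= λ v → just (trim v)) (runs-fromRuns a c r) ⟩
  (mapMaybe' (map value (c ∷ r)) >>= λ v → just (trim v))
    ≡⟨ cong (_>>= λ v → just (trim v)) (mapMaybe'-value (c ∷ r)) ⟩
  just (trim (c ∷ r))
    ∎
  where open ≡-Reasoning

dropFirst1-lead1 : ∀ z t → NonEmpty z → dropFirst1 (lead1 z ++ z ++ t) ≡ z ++ t
dropFirst1-lead1 (s1 ∷ z) t _ = refl
dropFirst1-lead1 (s2 ∷ z) t _ = refl

dropFirst1-lpad : ∀ z → NonEmpty z → dropFirst1 (lpad z) ≡ z
dropFirst1-lpad (s1 ∷ z) _ = refl
dropFirst1-lpad (s2 ∷ z) _ = refl

trim-pad : ∀ u → NonEmpty u → trim (pad u) ≡ u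
trim-pad u n = begin
  reverse (dropFirst1 (reverse (dropFirst1 (lead1 u ++ u ++ trail1 u))))
    ≡⟨ cong (reverse ∘ dropFirst1 ∘ reverse) (dropFirst1-lead1 u (trail1 u) n) ⟩
  reverse (dropFirst1 (reverse (u ++ trail1 u)))
    ≡⟨ cong (reverse ∘ dropFirst1) (reverse-++ u (trail1 u)) ⟩
  reverse (dropFirst1 (reverse (trail1 u) ++ reverse u))
    ≡⟨ cong (λ l → reverse (dropFirst1 (l ++ reverse u))) (lead1-reverse (reverse u)) ⟩
  reverse (dropFirst1 (lpad (reverse u)))
    ≡⟨ cong reverse (dropFirst1-lpad (reverse u) (nonEmpty-reverse u n)) ⟩
  reverse (reverse u)
    ≡⟨ reverse-involutive u ⟩
  u ∎
  where open ≡-Reasoning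

D-prim : ∀ y u → D (prim y u) ≡ just u
D-prim y []      = refl
D-prim y (c ∷ u) =
  trans (D-fromRuns y (pad (c ∷ u)) (pad-nonEmpty (c ∷ u) (ne c u))) (cong just (trim-pad (c ∷ u) (ne c u)))

-- Shortness: a primitive p of u has weight(Δ p) = |p|, and padding the trimmed word Δ p does not
-- increase its weight; hence |prim y u| ≤ |p|.

lead1-weight : ∀ w → weight (lead1 w) ≤ 1
lead1-weight []       = z≤n
lead1-weight (s1 ∷ _) = ≤-refl
lead1-weight (s2 ∷ _) = z≤n

lead1-dropFirst1 : ∀ v → weight (lead1 (dropFirst1 v)) + weight (dropFirst1 v) ≤ weight v
lead1-dropFirst1 []       = z≤n
lead1-dropFirst1 (s1 ∷ z) = +-mono-≤ (lead1-weight z) (≤-refl {weight z})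
lead1-dropFirst1 (s2 ∷ z) = ≤-refl

-- Removing a trailing 1 does not create a leading 1.
dropFirst1-suffix : ∀ v → Σ Word λ s → s ++ dropFirst1 v ≡ v
dropFirst1-suffix []       = [] , refl
dropFirst1-suffix (s1 ∷ v) = s1 ∷ [] , refl
dropFirst1-suffix (s2 ∷ v) = [] , refl

dropLast1-prefix : ∀ z → Σ Word λ s → dropLast1 z ++ s ≡ z
dropLast1-prefix z with dropFirst1-suffix (reverse z)
... | s , eq = reverse s , (begin
  reverse (dropFirst1 (reverse z)) ++ reverse s  ≡⟨ sym (reverse-++ s _) ⟩
  reverse (s ++ dropFirst1 (reverse z))          ≡⟨ cong reverse eq ⟩
  reverse (reverse z)                            ≡⟨ reverse-involutive z ⟩
  z                                              ∎)
  where open ≡-Reasoning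

lead1-prefix : ∀ xs ys → weight (lead1 xs) ≤ weight (lead1 (xs ++ ys))
lead1-prefix []        ys = z≤n
lead1-prefix (s1 ∷ xs) ys = ≤-refl
lead1-prefix (s2 ∷ xs) ys = ≤-refl

lead1-dropLast1 : ∀ z → weight (lead1 (dropLast1 z)) ≤ weight (lead1 z)
lead1-dropLast1 z with dropLast1-prefix z
... | s , eq = subst (λ w → weight (lead1 (dropLast1 z)) ≤ weight (lead1 w)) eq (lead1-prefix (dropLast1 z) s)

weight-pad-trim : ∀ v → weight (pad (trim v)) ≤ weight v
weight-pad-trim v = begin
  weight (lead1 (reverse r) ++ reverse r ++ lead1 (reverse (reverse r)))
    ≡⟨ trans (weight-++ (lead1 (reverse r)) _) (cong (weight (lead1 (reverse r)) +_) (weight-++ (reverse r) _)) ⟩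
  weight (lead1 (reverse r)) + (weight (reverse r) + weight (lead1 (reverse (reverse r))))
    ≡⟨ cong₂ (λ a b → weight (lead1 (reverse r)) + (a + b))
             (weight-reverse r) (cong (weight ∘ lead1) (reverse-involutive r)) ⟩
  weight (lead1 (reverse r)) + (weight r + weight (lead1 r))
    ≡⟨ cong (weight (lead1 (reverse r)) +_) (+-comm (weight r) _) ⟩
  weight (lead1 (dropLast1 z)) + (weight (lead1 r) + weight r)
    ≤⟨ +-mono-≤ (lead1-dropLast1 z) (lead1-dropFirst1 (reverse z)) ⟩
  weight (lead1 z) + weight (reverse z)
    ≡⟨ cong (weight (lead1 z) +_) (weight-reverse z) ⟩
  weight (lead1 z) + weight z
    ≤⟨ lead1-dropFirst1 v ⟩
  weight v ∎
  where
  open ≤-Reasoning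
  z = dropFirst1 v
  r = dropFirst1 (reverse z)

sum-runsFrom : ∀ x n ys → sum (runsFrom x n ys) ≡ n + length ys
sum-runsFrom x n []       = refl
sum-runsFrom x n (y ∷ ys) with x == y
... | true  = trans (sum-runsFrom x (suc n) ys) (sym (+-suc n (length ys)))
... | false = cong (n +_) (sum-runsFrom y 1 ys)

prim-shortest : ∀ y u p → D p ≡ just u → length (prim y u) ≤ length p
prim-shortest y .[] []      refl = z≤n
prim-shortest y u   (x ∷ p) e with mapMaybe' (runsFrom x 1 p) in Δp
prim-shortest y u   (x ∷ p) () | nothing
prim-shortest y u   (x ∷ p) e  | just v with just-injective e
... | refl = begin
  length (prim y (trim v))  ≡⟨ length-fromRuns y (pad (trim v)) ⟩
  weight (pad (trim v))     ≤⟨ weight-pad-trim v ⟩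
  weight v                  ≡⟨ cong sum (mapMaybe'-sound (runsFrom x 1 p) v Δp) ⟩
  sum (runsFrom x 1 p)      ≡⟨ sum-runsFrom x 1 p ⟩
  length (x ∷ p)            ∎
  where open ≤-Reasoning

-- Heights and minimality of towers

IsRoot : Word → Set
IsRoot t = NonEmpty t × D t ≡ just []

letter-root : ∀ x → IsRoot (x ∷ [])
letter-root x = ne x [] , refl

pair-root : ∀ x → IsRoot (x ∷ flip x ∷ [])
pair-root s1 = ne _ _ , refl
pair-root s2 = ne _ _ , refl

Dⁿ-suc : ∀ {w v} → D w ≡ just v → ∀ j → Dⁿ (suc j) w ≡ Dⁿ j v
Dⁿ-suc e zero    = e
Dⁿ-suc e (suc j) = cong (_>>= D) (Dⁿ-suc e j)

Dⁿ-ε : ∀ j → Dⁿ j [] ≡ just []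
Dⁿ-ε zero    = refl
Dⁿ-ε (suc j) = cong (_>>= D) (Dⁿ-ε j)

Dⁿ-tower : ∀ Y t → Dⁿ (length Y) (tower Y t) ≡ just t
Dⁿ-tower []      t = refl
Dⁿ-tower (y ∷ Y) t = trans (Dⁿ-suc (D-prim y (tower Y t)) (length Y)) (Dⁿ-tower Y t)

height-ε : Height [] 0
height-ε = refl , λ _ ()

height-step : ∀ {w u k} → NonEmpty w → D w ≡ just u → Height u k → Height w (suc k)
height-step {w} {k = k} nw e (reaches , avoids) = trans (Dⁿ-suc e k) reaches , earlier
  where
  earlier : ∀ j → j < suc k → ¬ (Dⁿ j w ≡ just [])
  earlier zero    _         eq = nonEmpty≢ε nw (just-injective eq)
  earlier (suc j) (s≤s j<k) eq = avoids j j<k (trans (sym (Dⁿ-suc e j)) eq)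

height-D : ∀ {w u k} → D w ≡ just u → Height w (suc k) → Height u k
height-D {k = k} e (reaches , avoids) =
  trans (sym (Dⁿ-suc e k)) reaches , λ j j<k eq → avoids (suc j) (s≤s j<k) (trans (Dⁿ-suc e j) eq)

height-unique : ∀ {w k k′} → Height w k → Height w k′ → k ≡ k′
height-unique {k = k} {k′} (reaches , avoids) (reaches′ , avoids′) with <-cmp k k′
... | tri< k<k′ _ _ = ⊥-elim (avoids′ k k<k′ reaches)
... | tri≈ _ k≡k′ _ = k≡k′
... | tri> _ _ k′<k = ⊥-elim (avoids k′ k′<k reaches′)

height-root : ∀ {t} → IsRoot t → Height t 1
height-root (nt , e) = height-step nt e height-ε

height-tower : ∀ Y {t} → IsRoot t → Height (tower Y t) (suc (length Y))
height-tower []      root       = height-root root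
height-tower (y ∷ Y) root@(nt , _) =
  height-step (prim-nonEmpty y _ (tower-nonEmpty Y _ nt)) (D-prim y _) (height-tower Y root)

inC∞-ε : InC∞ []
inC∞-ε j = [] , Dⁿ-ε j

inC∞-step : ∀ {w v} → D w ≡ just v → InC∞ v → InC∞ w
inC∞-step {w} e inC zero    = w , refl
inC∞-step     e inC (suc j) = proj₁ (inC j) , trans (Dⁿ-suc e j) (proj₂ (inC j))

ShortestPrimitives : Word → Set
ShortestPrimitives w = ∀ k → Height w k → ∀ j → suc (suc j) ≤ k → ∀ v u → Dⁿ j w ≡ just v →
  Dⁿ (suc j) w ≡ just u → ∀ p → IsPrimitive p u → length v ≤ length p

minimal-root : ∀ {t} → IsRoot t → Minimal t
minimal-root {t} root@(_ , e) = inC∞-step e inC∞-ε , heightOne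
  where
  heightOne : ShortestPrimitives t
  heightOne k h j le with height-unique h (height-root root)
  heightOne .1 h j (s≤s ()) | refl

minimal-prim : ∀ y {u} → Minimal u → Minimal (prim y u)
minimal-prim y {u} (inC , shortest) = inC∞-step (D-prim y u) inC , shortestAbove
  where
  shortestAbove : ShortestPrimitives (prim y u)
  shortestAbove k h zero le v u′ e0 e1 p p-prim
    with just-injective e0 | just-injective (trans (sym e1) (D-prim y u))
  ... | refl | refl = prim-shortest y u p p-prim
  shortestAbove (suc k) h (suc j) (s≤s le) v u′ e0 e1 p p-prim =
    shortest k (height-D (D-prim y u) h) j le v u′
      (trans (sym (Dⁿ-suc (D-prim y u) j)) e0) (trans (sym (Dⁿ-suc (D-prim y u) (suc j))) e1) p p-prim

minimal-tower : ∀ Y {t} → IsRoot t → Minimal (tower Y t)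
minimal-tower []      root = minimal-root root
minimal-tower (y ∷ Y) root = minimal-prim y (minimal-tower Y root)

-- Frontiers of towers

psiAt-zero : ∀ w → NonEmpty w → psiAt w 0 ≡ just (embed (firstLetter w))
psiAt-zero (x ∷ w) _ = refl

-- prim y u starts with two equal letters exactly when u starts with 2, so the letter following y in
-- its left frontier is the first letter of u, never 0 (the four cases are computed).
prim-secondLetter : ∀ y c u → (firstTwoDiffer (prim y (c ∷ u)) >>= λ d →
                      just (if (c == s2) then (if d then z0 else embed c) else embed c)) ≡ just (embed c)
prim-secondLetter s1 s1 u = refl
prim-secondLetter s1 s2 u = refl
prim-secondLetter s2 s1 u = refl
prim-secondLetter s2 s2 u = refl

psiAt-prim : ∀ y u → NonEmpty u → ∀ i → psiAt (prim y u) (suc i) ≡ psiAt u i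
psiAt-prim y (c ∷ u) _ zero    = trans (cong (_>>= continue) (D-prim y (c ∷ u))) (prim-secondLetter y c u)
  where
  continue : Word → Maybe Sym0
  continue u′ = head0 u′ >>= λ a → firstTwoDiffer (prim y (c ∷ u)) >>= λ d →
                just (if (a == s2) then (if d then z0 else embed a) else embed a)
psiAt-prim y u       _ (suc i) = cong (_>>= _) (Dⁿ-suc (D-prim y u) i)

Ψ-prim : ∀ y u n → NonEmpty u → Ψ (prim y u) (suc n) ≡ (Ψ u n >>= λ xs → just (embed y ∷ xs))
Ψ-prim y u n nu = cong₂ (λ m ms → sequenceM (m ∷ ms)) first rest
  where
  open ≡-Reasoning
  w = prim y u
  first : psiAt w 0 ≡ just (embed y)
  first = trans (psiAt-zero w (prim-nonEmpty y u nu)) (cong (just ∘ embed) (firstLetter-prim y u nu))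
  rest : map (psiAt w) (applyUpTo suc n) ≡ map (psiAt u) (upTo n)
  rest = begin
    map (psiAt w) (applyUpTo suc n)            ≡⟨ map-applyUpTo suc (psiAt w) n ⟩
    applyUpTo (λ i → psiAt w (suc i)) n        ≡⟨ sym (map-upTo _ n) ⟩
    map (λ i → psiAt w (suc i)) (upTo n)       ≡⟨ map-cong (psiAt-prim y u nu) (upTo n) ⟩
    map (psiAt u) (upTo n)                     ∎

Ψ-tower : ∀ Y t → NonEmpty t → Ψ (tower Y t) (suc (length Y)) ≡ just (map embed (Y ∷ʳ firstLetter t))
Ψ-tower []      t nt = cong (λ m → sequenceM (m ∷ [])) (psiAt-zero t nt)
Ψ-tower (y ∷ Y) t nt =
  trans (Ψ-prim y (tower Y t) (suc (length Y)) (tower-nonEmpty Y t nt))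
        (cong (_>>= λ xs → just (embed y ∷ xs)) (Ψ-tower Y t nt))

leftFrontier-tower : ∀ Y {t} → IsRoot t → LeftFrontier (tower Y t) (map embed (Y ∷ʳ firstLetter t))
leftFrontier-tower Y {t} root@(nt , _) = suc (length Y) , height-tower Y root , Ψ-tower Y t nt

leftFrontier-unique : ∀ {w V V′} → LeftFrontier w V → LeftFrontier w V′ → V ≡ V′
leftFrontier-unique (k , h , e) (k′ , h′ , e′) with height-unique h h′
... | refl = just-injective (trans (sym e) e′)

embed-injective : ∀ {a b} → embed a ≡ embed b → a ≡ b
embed-injective {s1} {s1} _ = refl
embed-injective {s2} {s2} _ = refl
embed-injective {s1} {s2} ()
embed-injective {s2} {s1} ()

-- The right frontier of a tower is the left frontier of its reversal, the tower of its right edge.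
rightFrontier-tower : ∀ U {t} V → IsRoot t → IsRoot (reverse t) → RightFrontier (tower U t) (map embed V) →
                      V ≡ rightEdge U t ∷ʳ firstLetter (reverse t)
rightFrontier-tower U {t} V (nt , _) reverseRoot frontier =
  map-injective embed-injective (leftFrontier-unique frontier reversed)
  where
  reversed : LeftFrontier (reverse (tower U t)) (map embed (rightEdge U t ∷ʳ firstLetter (reverse t)))
  reversed = subst (λ w → LeftFrontier w (map embed (rightEdge U t ∷ʳ firstLetter (reverse t))))
                   (sym (reverse-tower U t)) (leftFrontier-tower (rightEdge U t) reverseRoot)

-- Γs and Γd on a word U x: the minimal word with left frontier U x and root x (resp. x x̄) is the tower
-- of U over that root, so its right frontier is read off the right edge.
Γs-∷ʳ-formula : ∀ Γs → IsΓs Γs → ∀ U x → Γs (U ∷ʳ x) ≡ rightEdge U (x ∷ []) ∷ʳ x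
Γs-∷ʳ-formula Γs (_ , frontier) U x =
  rightFrontier-tower U (Γs (U ∷ʳ x)) root root
    (frontier (U ∷ʳ x) (tower U (x ∷ [])) (minimal-tower U root) singleRooted (leftFrontier-tower U root))
  where
  root = letter-root x
  singleRooted : SingleRooted (tower U (x ∷ []))
  singleRooted = length U , x ∷ [] , height-tower U root , Dⁿ-tower U (x ∷ []) , refl

Γd-∷ʳ-formula : ∀ Γd → IsΓd Γd → ∀ U x → Γd (U ∷ʳ x) ≡ rightEdge U (x ∷ flip x ∷ []) ∷ʳ flip x
Γd-∷ʳ-formula Γd (_ , frontier) U x =
  rightFrontier-tower U (Γd (U ∷ʳ x)) root reverseRoot
    (frontier (U ∷ʳ x) (tower U t) (minimal-tower U root) doubleRooted (leftFrontier-tower U root))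
  where
  t = x ∷ flip x ∷ []
  root = pair-root x
  reverseRoot : IsRoot (flip x ∷ x ∷ [])
  reverseRoot = subst (λ z → IsRoot (flip x ∷ z ∷ [])) (flip-involutive x) (pair-root (flip x))
  doubleRooted : DoubleRooted (tower U t)
  doubleRooted = length U , t , height-tower U root , Dⁿ-tower U t , refl

-- Locality of shortest primitives

prim-++-pads : ∀ q C S → NonEmpty C → NonEmpty S →
               prim q (C ++ S) ≡ fromRuns q (lpad C) ++ fromRuns (afterRuns q (lpad C)) (rpad S)
prim-++-pads q C S nC nS = trans (cong (fromRuns q) (pad-++ C S nC nS)) (fromRuns-++ q (lpad C) (rpad S))

-- Hence prim q (C S) is a word depending only on q, C and the first letter of S, followed by a shortest
-- primitive of S.  When S starts with 1, the last letter contributed by C is absorbed into that primitive.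
primHead : Sym → Word → Sym → Word
primHead q []      _  = []
primHead q (c ∷ C) s1 = dropLast (fromRuns q (lpad (c ∷ C)))
primHead q (c ∷ C) s2 = fromRuns q (lpad (c ∷ C))

primNext : Sym → Word → Sym → Sym
primNext q []      _  = q
primNext q (c ∷ C) s1 = flip (afterRuns q (lpad (c ∷ C)))
primNext q (c ∷ C) s2 = afterRuns q (lpad (c ∷ C))

prim-++ : ∀ q C S → NonEmpty S →
          prim q (C ++ S) ≡ primHead q C (firstLetter S) ++ prim (primNext q C (firstLetter S)) S
prim-++ q []      S        _  = refl
prim-++ q (c ∷ C) (s2 ∷ S) nS = prim-++-pads q (c ∷ C) (s2 ∷ S) (ne c C) nS
prim-++ q (c ∷ C) (s1 ∷ S) nS = begin
  prim q ((c ∷ C) ++ s1 ∷ S)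
    ≡⟨ prim-++-pads q (c ∷ C) (s1 ∷ S) (ne c C) nS ⟩
  F ++ fromRuns m (rpad (s1 ∷ S))
    ≡⟨ cong (_++ fromRuns m (rpad (s1 ∷ S)))
            (fromRuns-split-last q (lpad (c ∷ C)) (lpad-nonEmpty (c ∷ C) (ne c C))) ⟩
  (dropLast F ∷ʳ flip m) ++ fromRuns m (rpad (s1 ∷ S))
    ≡⟨ ++-assoc (dropLast F) (flip m ∷ []) _ ⟩
  dropLast F ++ flip m ∷ fromRuns m (rpad (s1 ∷ S))
    ≡⟨ cong (λ z → dropLast F ++ flip m ∷ fromRuns z (rpad (s1 ∷ S))) (sym (flip-involutive m)) ⟩
  dropLast F ++ prim (flip m) (s1 ∷ S)
    ∎
  where
  open ≡-Reasoning
  F = fromRuns q (lpad (c ∷ C))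
  m = afterRuns q (lpad (c ∷ C))

prim-retarget : ∀ y r C C₀ {XA XB} → NonEmpty XA → NonEmpty XB → firstLetter XA ≡ firstLetter XB →
                prim y (C ++ XA) ≡ C₀ ++ prim r XA → prim y (C ++ XB) ≡ C₀ ++ prim r XB
prim-retarget y r C C₀ {XA} {XB} nA nB sameFirst eq = begin
  prim y (C ++ XB)
    ≡⟨ prim-++ y C XB nB ⟩
  primHead y C (firstLetter XB) ++ prim (primNext y C (firstLetter XB)) XB
    ≡⟨ cong (λ a → primHead y C a ++ prim (primNext y C a) XB) (sym sameFirst) ⟩
  primHead y C h ++ prim (primNext y C h) XB
    ≡⟨ cong₂ (λ H q → H ++ prim q XB) (proj₁ split) next≡r ⟩
  C₀ ++ prim r XB
    ∎
  where
  open ≡-Reasoning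
  h = firstLetter XA
  split : primHead y C h ≡ C₀ × prim (primNext y C h) XA ≡ prim r XA
  split = ++-cancel-suffix _ C₀ (length-prim _ r XA) (trans (sym (prim-++ y C XA nA)) eq)
  next≡r : primNext y C h ≡ r
  next≡r = trans (sym (firstLetter-prim _ XA nA)) (trans (cong firstLetter (proj₂ split)) (firstLetter-prim r XA nA))

trail1-absorbed : ∀ n t R → t ≡ [] ⊎ t ≡ s1 ∷ [] → NonEmpty R →
                  Σ Word λ R′ → NonEmpty R′ × fromRuns n (rpad R) ≡ fromRuns n t ++ R′
trail1-absorbed n t R (inj₁ refl) nR = fromRuns n (rpad R) , fromRuns-nonEmpty n (rpad R) (nonEmpty-++ R _ nR) , refl
trail1-absorbed n t (s1 ∷ R) (inj₂ refl) _ =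
  fromRuns (flip n) (R ++ trail1 (s1 ∷ R)) , fromRuns-nonEmpty (flip n) _ (longPad R) , refl
  where
  longPad : ∀ R → NonEmpty (R ++ trail1 (s1 ∷ R))
  longPad []      = ne s1 []
  longPad (x ∷ R) = ne x _
trail1-absorbed n t (s2 ∷ R) (inj₂ refl) _ = n ∷ fromRuns (flip n) (R ++ trail1 (s2 ∷ R)) , ne n _ , refl

prim-extend : ∀ y A R → NonEmpty A → NonEmpty R →
              Σ Word λ R′ → NonEmpty R′ × prim y (A ++ R) ≡ prim y A ++ R′
prim-extend y A R nA nR with trail1-absorbed (afterRuns y (lpad A)) (trail1 A) R (trail1-cases A) nR
... | R′ , nR′ , absorbed = R′ , nR′ , (begin
  prim y (A ++ R)                          ≡⟨ prim-++-pads y A R nA nR ⟩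
  F ++ fromRuns n (rpad R)                 ≡⟨ cong (F ++_) absorbed ⟩
  F ++ fromRuns n (trail1 A) ++ R′         ≡⟨ sym (++-assoc F _ R′) ⟩
  (F ++ fromRuns n (trail1 A)) ++ R′       ≡⟨ cong (_++ R′) (sym primA) ⟩
  prim y A ++ R′                           ∎)
  where
  open ≡-Reasoning
  F = fromRuns y (lpad A)
  n = afterRuns y (lpad A)
  primA : prim y A ≡ F ++ fromRuns n (trail1 A)
  primA = trans (cong (fromRuns y) (pad-lpad A)) (fromRuns-++ y (lpad A) (trail1 A))

-- Comparing towers level by level

Decomposes : Word → Word → List Word → Word → Word → Set
Decomposes Y t Cs R s = levels Y t ≡ zipWith _++_ Cs (levels R s)

rightEdge-decomposes : ∀ Y R {t s} Cs → NonEmpty s → length Y ≡ length R → Decomposes Y t Cs R s →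
                       rightEdge Y t ≡ rightEdge R s
rightEdge-decomposes []      []      Cs       ns l  eq = refl
rightEdge-decomposes []      (_ ∷ _) Cs       ns () eq
rightEdge-decomposes (_ ∷ _) []      Cs       ns () eq
rightEdge-decomposes (y ∷ Y) (r ∷ R) []       ns l  ()
rightEdge-decomposes (y ∷ Y) (r ∷ R) {s = s} (C ∷ Cs) ns l eq = cong₂ _∷_ sameLast below
  where
  sameLast = trans (cong lastLetter (∷-injectiveˡ eq)) (lastLetter-++ C _ (tower-nonEmpty (r ∷ R) s ns))
  below    = rightEdge-decomposes Y R Cs ns (suc-injective l) (∷-injectiveʳ eq)

decomposes-retarget : ∀ Y R c {sA sB} Cs → NonEmpty sA → NonEmpty sB → firstLetter sA ≡ firstLetter sB →
  length Y ≡ length R → Decomposes Y (c ++ sA) Cs R sA → Decomposes Y (c ++ sB) Cs R sB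
decomposes-retarget []      []      c [] nA nB h l ()
decomposes-retarget []      []      c {sB = sB} (C ∷ Cs) nA nB h l eq =
  cong₂ _∷_ (cong (_++ sB) (proj₁ (++-cancel-suffix c C refl (∷-injectiveˡ eq)))) (∷-injectiveʳ eq)
decomposes-retarget []      (_ ∷ _) c Cs nA nB h () eq
decomposes-retarget (_ ∷ _) []      c Cs nA nB h () eq
decomposes-retarget (y ∷ Y) (r ∷ R) c []        nA nB h l ()
decomposes-retarget (y ∷ Y) (r ∷ R) c (C₀ ∷ []) nA nB h l eq with ∷-injectiveʳ eq
... | ()
decomposes-retarget (y ∷ Y) (r ∷ R) c {sA} {sB} (C₀ ∷ C₁ ∷ Cs) nA nB h l eq = cong₂ _∷_ top below
  where
  below : Decomposes Y (c ++ sB) (C₁ ∷ Cs) R sB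
  below = decomposes-retarget Y R c (C₁ ∷ Cs) nA nB h (suc-injective l) (∷-injectiveʳ eq)
  topA : prim y (C₁ ++ tower R sA) ≡ C₀ ++ prim r (tower R sA)
  topA = trans (cong (prim y) (sym (∷-injectiveˡ (∷-injectiveʳ eq)))) (∷-injectiveˡ eq)
  top : prim y (tower Y (c ++ sB)) ≡ C₀ ++ prim r (tower R sB)
  top = trans (cong (prim y) (∷-injectiveˡ below))
              (prim-retarget y r C₁ C₀ (tower-nonEmpty R sA nA) (tower-nonEmpty R sB nB)
                             (tower-firstLetter R nA nB h) topA)

levels-extend : ∀ Y A R → NonEmpty A → NonEmpty R →
                Σ Word λ R₀ → Σ (List Word) λ Rs →
                NonEmpty R₀ × levels Y (A ++ R) ≡ zipWith _++_ (levels Y A) (R₀ ∷ Rs)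
levels-extend []      A R nA nR = R , [] , nR , refl
levels-extend (y ∷ Y) A R nA nR with levels-extend Y A R nA nR
... | R₀ , Rs , nR₀ , below with prim-extend y (tower Y A) R₀ (tower-nonEmpty Y A nA) nR₀
...   | R′ , nR′ , top =
  R′ , R₀ ∷ Rs , nR′ , cong₂ _∷_ (trans (cong (prim y) (∷-injectiveˡ below)) top) below

map-reverse-zipWith : ∀ (xs ys : List Word) →
                      map reverse (zipWith _++_ xs ys) ≡ zipWith _++_ (map reverse ys) (map reverse xs)
map-reverse-zipWith []       []       = refl
map-reverse-zipWith []       (_ ∷ _)  = refl
map-reverse-zipWith (_ ∷ _)  []       = refl
map-reverse-zipWith (x ∷ xs) (y ∷ ys) = cong₂ _∷_ (reverse-++ x y) (map-reverse-zipWith xs ys)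

reflect-extension : ∀ Y A R → NonEmpty A → NonEmpty R →
  Σ (List Word) λ Cs → Decomposes (rightEdge Y (A ++ R)) (reverse R ++ reverse A) Cs (rightEdge Y A) (reverse A)
reflect-extension Y A R nA nR with levels-extend Y A R nA nR
... | R₀ , Rs , _ , extended = map reverse (R₀ ∷ Rs) , (begin
  levels (rightEdge Y (A ++ R)) (reverse R ++ reverse A)      ≡⟨ cong (levels _) (sym (reverse-++ A R)) ⟩
  levels (rightEdge Y (A ++ R)) (reverse (A ++ R))            ≡⟨ sym (reverse-levels Y (A ++ R)) ⟩
  map reverse (levels Y (A ++ R))                             ≡⟨ cong (map reverse) extended ⟩
  map reverse (zipWith _++_ (levels Y A) (R₀ ∷ Rs))           ≡⟨ map-reverse-zipWith (levels Y A) (R₀ ∷ Rs) ⟩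
  zipWith _++_ (map reverse (R₀ ∷ Rs)) (map reverse (levels Y A))
                                                              ≡⟨ cong (zipWith _++_ _) (reverse-levels Y A) ⟩
  zipWith _++_ (map reverse (R₀ ∷ Rs)) (levels (rightEdge Y A) (reverse A)) ∎)
  where open ≡-Reasoning

-- The transfer principle: after reflecting the tower over A R, the part coming from R can be
-- carried along while the root ‾A‾ is replaced by any s starting with the same letter.
rightEdge-transfer : ∀ Y A R s → NonEmpty A → NonEmpty R → NonEmpty s →
  firstLetter s ≡ firstLetter (reverse A) →
  rightEdge (rightEdge Y (A ++ R)) (reverse R ++ s) ≡ rightEdge (rightEdge Y A) s
rightEdge-transfer Y A R s nA nR ns sameFirst with reflect-extension Y A R nA nR
... | Cs , reflected =
  rightEdge-decomposes (rightEdge Y (A ++ R)) (rightEdge Y A) Cs ns sameLength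
    (decomposes-retarget _ _ (reverse R) Cs (nonEmpty-reverse A nA) ns (sym sameFirst) sameLength reflected)
  where
  sameLength = trans (length-rightEdge Y (A ++ R)) (sym (length-rightEdge Y A))

-- Changing the last letter of the root

DifferAtEnd : Word → Word → Set
DifferAtEnd u v = Σ Word λ A → NonEmpty A × Σ Sym λ c → u ≡ A ∷ʳ c × v ≡ A ∷ʳ flip c

-- The last letter of the shortest primitive starting with n of a one-letter word c.
ending : Sym → Sym → Sym
ending n s1 = flip n
ending n s2 = n

ending-flip : ∀ n c → ending n (flip c) ≡ flip (ending n c)
ending-flip n s1 = sym (flip-involutive n)
ending-flip n s2 = refl

prim-∷ʳ : ∀ y A c → NonEmpty A →
          prim y (A ∷ʳ c) ≡ (fromRuns y (lpad A) ∷ʳ afterRuns y (lpad A)) ∷ʳ ending (afterRuns y (lpad A)) c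
prim-∷ʳ y A c nA = trans (prim-++-pads y A (c ∷ []) nA (ne c [])) (pair c)
  where
  F = fromRuns y (lpad A)
  n = afterRuns y (lpad A)
  pair : ∀ c → F ++ fromRuns n (rpad (c ∷ [])) ≡ (F ∷ʳ n) ∷ʳ ending n c
  pair s1 = sym (++-assoc F (n ∷ []) _)
  pair s2 = sym (++-assoc F (n ∷ []) _)

differAtEnd-prim : ∀ y {u v} → DifferAtEnd u v → DifferAtEnd (prim y u) (prim y v)
differAtEnd-prim y (A , nA , c , refl , refl) =
  F ∷ʳ n , nonEmpty-∷ʳ F n , ending n c , prim-∷ʳ y A c nA ,
  trans (prim-∷ʳ y A (flip c) nA) (cong ((F ∷ʳ n) ∷ʳ_) (ending-flip n c))
  where
  F = fromRuns y (lpad A)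
  n = afterRuns y (lpad A)

differAtEnd-tower : ∀ Y {u v} → DifferAtEnd u v → DifferAtEnd (tower Y u) (tower Y v)
differAtEnd-tower []      d = d
differAtEnd-tower (y ∷ Y) d = differAtEnd-prim y (differAtEnd-tower Y d)

rightEdge-complement : ∀ Y {u v} → DifferAtEnd u v → rightEdge Y u ≡ comp (rightEdge Y v)
rightEdge-complement []      d = refl
rightEdge-complement (y ∷ Y) {u} {v} d with differAtEnd-tower (y ∷ Y) d
... | A , _ , c , top-u , top-v = cong₂ _∷_ oppositeLast (rightEdge-complement Y d)
  where
  open ≡-Reasoning
  oppositeLast : lastLetter (prim y (tower Y u)) ≡ flip (lastLetter (prim y (tower Y v)))
  oppositeLast = begin
    lastLetter (prim y (tower Y u))           ≡⟨ cong lastLetter top-u ⟩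
    lastLetter (A ∷ʳ c)                       ≡⟨ lastLetter-∷ʳ A c ⟩
    c                                         ≡⟨ sym (flip-involutive c) ⟩
    flip (flip c)                             ≡⟨ cong flip (sym (lastLetter-∷ʳ A (flip c))) ⟩
    flip (lastLetter (A ∷ʳ flip c))           ≡⟨ cong (flip ∘ lastLetter) (sym top-v) ⟩
    flip (lastLetter (prim y (tower Y v)))    ∎

prim-1 : ∀ w → prim w (s1 ∷ []) ≡ w ∷ flip w ∷ w ∷ []
prim-1 s1 = refl
prim-1 s2 = refl

prims-of-X̄X : ∀ x X → Σ Word λ R → NonEmpty R × prim x (flip X ∷ []) ≡ x ∷ R ×
               lastLetter (prim x (flip X ∷ [])) ≡ x × prim x (flip X ∷ X ∷ []) ≡ reverse R ++ prim x (X ∷ [])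
prims-of-X̄X s1 s1 = s1 ∷ [] ,      ne _ _ , refl , refl , refl
prims-of-X̄X s1 s2 = s2 ∷ s1 ∷ [] , ne _ _ , refl , refl , refl
prims-of-X̄X s2 s1 = s2 ∷ [] ,      ne _ _ , refl , refl , refl
prims-of-X̄X s2 s2 = s1 ∷ s2 ∷ [] , ne _ _ , refl , refl , refl

rightEdge-alternating : ∀ W w → rightEdge W (w ∷ flip w ∷ w ∷ []) ≡
  rightEdge (rightEdge (rightEdge W (w ∷ flip w ∷ [])) (flip w ∷ [])) (flip w ∷ w ∷ [])
rightEdge-alternating W w = begin
  rightEdge W (w ∷ flip w ∷ w ∷ [])
    ≡⟨ cong (λ Y → rightEdge Y (w ∷ flip w ∷ w ∷ []))
            (sym (rightEdge-involutive W (w ∷ flip w ∷ []) (ne _ _))) ⟩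
  rightEdge (rightEdge Z (flip w ∷ w ∷ [])) (w ∷ flip w ∷ w ∷ [])
    ≡⟨ rightEdge-transfer Z (flip w ∷ []) (w ∷ []) (flip w ∷ w ∷ []) (ne _ []) (ne w []) (ne _ _) refl ⟩
  rightEdge (rightEdge Z (flip w ∷ [])) (flip w ∷ w ∷ [])
    ∎
  where
  open ≡-Reasoning
  Z = rightEdge W (w ∷ flip w ∷ [])

rightEdge-∷ʳ-shift : ∀ U x X → rightEdge (U ∷ʳ x) (X ∷ []) ≡
  rightEdge (rightEdge (rightEdge U (x ∷ []) ∷ʳ x) (flip X ∷ [])) (flip X ∷ X ∷ [])
rightEdge-∷ʳ-shift U x X with prims-of-X̄X x X
... | R , nR , primX̄ , lastX̄ , primX̄X = begin
  rightEdge (U ∷ʳ x) (X ∷ [])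
    ≡⟨ rightEdge-∷ʳ U x (X ∷ []) ⟩
  rightEdge U (prim x (X ∷ [])) ∷ʳ lastLetter (prim x (X ∷ []))
    ≡⟨ cong₂ _∷ʳ_ (sym transferred) (sym sameLast) ⟩
  rightEdge Q (prim x (flip X ∷ X ∷ [])) ∷ʳ lastLetter (prim x (flip X ∷ X ∷ []))
    ≡⟨ sym (rightEdge-∷ʳ Q x (flip X ∷ X ∷ [])) ⟩
  rightEdge (Q ∷ʳ x) (flip X ∷ X ∷ [])
    ≡⟨ cong (λ Y → rightEdge Y (flip X ∷ X ∷ [])) (sym Q∷ʳx) ⟩
  rightEdge (rightEdge (W ∷ʳ x) (flip X ∷ [])) (flip X ∷ X ∷ [])
    ∎
  where
  open ≡-Reasoning
  W = rightEdge U (x ∷ [])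
  Q = rightEdge W (prim x (flip X ∷ []))
  nX = prim-nonEmpty x (X ∷ []) (ne X [])
  Q∷ʳx : rightEdge (W ∷ʳ x) (flip X ∷ []) ≡ Q ∷ʳ x
  Q∷ʳx = trans (rightEdge-∷ʳ W x (flip X ∷ [])) (cong (Q ∷ʳ_) lastX̄)
  sameLast : lastLetter (prim x (flip X ∷ X ∷ [])) ≡ lastLetter (prim x (X ∷ []))
  sameLast = trans (cong lastLetter primX̄X) (lastLetter-++ (reverse R) _ nX)
  transferred : rightEdge Q (prim x (flip X ∷ X ∷ [])) ≡ rightEdge U (prim x (X ∷ []))
  transferred = begin
    rightEdge Q (prim x (flip X ∷ X ∷ []))
      ≡⟨ cong₂ rightEdge (cong (rightEdge W) primX̄) primX̄X ⟩
    rightEdge (rightEdge W (x ∷ R)) (reverse R ++ prim x (X ∷ []))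
      ≡⟨ rightEdge-transfer W (x ∷ []) R _ (ne x []) nR nX (firstLetter-prim x (X ∷ []) (ne X [])) ⟩
    rightEdge (rightEdge W (x ∷ [])) (prim x (X ∷ []))
      ≡⟨ cong (λ Y → rightEdge Y (prim x (X ∷ []))) (rightEdge-involutive U (x ∷ []) (ne x [])) ⟩
    rightEdge U (prim x (X ∷ []))
      ∎

-- The algebra of Γs and Γd

module Consequences
  (Γs Γd : Word → Word) (Γs-ε : Γs [] ≡ []) (Γd-ε : Γd [] ≡ [])
  (Γs-∷ʳ : ∀ U x → Γs (U ∷ʳ x) ≡ rightEdge U (x ∷ []) ∷ʳ x)
  (Γd-∷ʳ : ∀ U x → Γd (U ∷ʳ x) ≡ rightEdge U (x ∷ flip x ∷ []) ∷ʳ flip x)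
  where

  open ≡-Reasoning

  -- The formula for Γd on U x̄, written without double complements.
  Γd-∷ʳ-flip : ∀ U x → Γd (U ∷ʳ flip x) ≡ rightEdge U (flip x ∷ x ∷ []) ∷ʳ x
  Γd-∷ʳ-flip U x =
    trans (Γd-∷ʳ U (flip x)) (cong (λ z → rightEdge U (flip x ∷ z ∷ []) ∷ʳ z) (flip-involutive x))

  -- Γs and Γd are involutions, because rightEdge is.
  Γs-involutive : ∀ U → Γs (Γs U) ≡ U
  Γs-involutive U with initLast U
  ... | []        = trans (cong Γs Γs-ε) Γs-ε
  ... | U′ ∷ʳ′ x  = begin
    Γs (Γs (U′ ∷ʳ x))
      ≡⟨ cong Γs (Γs-∷ʳ U′ x) ⟩
    Γs (rightEdge U′ (x ∷ []) ∷ʳ x)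
      ≡⟨ Γs-∷ʳ _ x ⟩
    rightEdge (rightEdge U′ (x ∷ [])) (x ∷ []) ∷ʳ x
      ≡⟨ cong (_∷ʳ x) (rightEdge-involutive U′ (x ∷ []) (ne x [])) ⟩
    U′ ∷ʳ x ∎

  Γd-involutive : ∀ U → Γd (Γd U) ≡ U
  Γd-involutive U with initLast U
  ... | []        = trans (cong Γd Γd-ε) Γd-ε
  ... | U′ ∷ʳ′ x  = begin
    Γd (Γd (U′ ∷ʳ x))
      ≡⟨ cong Γd (Γd-∷ʳ U′ x) ⟩
    Γd (rightEdge U′ (x ∷ flip x ∷ []) ∷ʳ flip x)
      ≡⟨ Γd-∷ʳ-flip _ x ⟩
    rightEdge (rightEdge U′ (x ∷ flip x ∷ [])) (flip x ∷ x ∷ []) ∷ʳ x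
      ≡⟨ cong (_∷ʳ x) (rightEdge-involutive U′ (x ∷ flip x ∷ []) (ne _ _)) ⟩
    U′ ∷ʳ x ∎

  Γs-∷ʳ-via-Γd : ∀ U X → Γs (U ∷ʳ X) ≡ Γd (Γs (Γs U ∷ʳ flip X))
  Γs-∷ʳ-via-Γd U X with initLast U
  ... | [] = begin
    Γs (X ∷ [])                        ≡⟨ Γs-∷ʳ [] X ⟩
    X ∷ []                             ≡⟨ sym (Γd-∷ʳ-flip [] X) ⟩
    Γd (flip X ∷ [])                   ≡⟨ cong Γd (sym (Γs-∷ʳ [] (flip X))) ⟩
    Γd (Γs (flip X ∷ []))              ≡⟨ cong (λ V → Γd (Γs (V ∷ʳ flip X))) (sym Γs-ε) ⟩
    Γd (Γs (Γs [] ∷ʳ flip X))          ∎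
  ... | U′ ∷ʳ′ x = begin
    Γs ((U′ ∷ʳ x) ∷ʳ X)                ≡⟨ Γs-∷ʳ (U′ ∷ʳ x) X ⟩
    rightEdge (U′ ∷ʳ x) (X ∷ []) ∷ʳ X  ≡⟨ cong (_∷ʳ X) (rightEdge-∷ʳ-shift U′ x X) ⟩
    rightEdge Q (flip X ∷ X ∷ []) ∷ʳ X ≡⟨ sym (Γd-∷ʳ-flip Q X) ⟩
    Γd (Q ∷ʳ flip X)                   ≡⟨ cong Γd (sym (Γs-∷ʳ W (flip X))) ⟩
    Γd (Γs (W ∷ʳ flip X))              ≡⟨ cong (λ V → Γd (Γs (V ∷ʳ flip X))) (sym (Γs-∷ʳ U′ x)) ⟩
    Γd (Γs (Γs (U′ ∷ʳ x) ∷ʳ flip X))   ∎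
    where
    W = rightEdge U′ (x ∷ []) ∷ʳ x
    Q = rightEdge W (flip X ∷ [])

  -- Γs on words ending in 2: the right edges over x x and x x̄ are complementary.
  Γs-∷ʳ-2 : ∀ W → Γs (W ∷ʳ s2) ≡ comp (Γd W) ∷ʳ s2
  Γs-∷ʳ-2 W with initLast W
  ... | [] = trans (Γs-∷ʳ [] s2) (cong (λ V → comp V ∷ʳ s2) (sym Γd-ε))
  ... | W′ ∷ʳ′ w = begin
    Γs ((W′ ∷ʳ w) ∷ʳ s2)
      ≡⟨ Γs-∷ʳ (W′ ∷ʳ w) s2 ⟩
    rightEdge (W′ ∷ʳ w) (s2 ∷ []) ∷ʳ s2
      ≡⟨ cong (_∷ʳ s2) (rightEdge-∷ʳ W′ w (s2 ∷ [])) ⟩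
    (rightEdge W′ (w ∷ w ∷ []) ∷ʳ w) ∷ʳ s2
      ≡⟨ cong (λ V → (V ∷ʳ w) ∷ʳ s2) (rightEdge-complement W′ lastFlipped) ⟩
    (comp Z ∷ʳ w) ∷ʳ s2
      ≡⟨ cong (λ z → (comp Z ∷ʳ z) ∷ʳ s2) (sym (flip-involutive w)) ⟩
    (comp Z ∷ʳ flip (flip w)) ∷ʳ s2
      ≡⟨ cong (_∷ʳ s2) (sym (map-++ flip Z (flip w ∷ []))) ⟩
    comp (Z ∷ʳ flip w) ∷ʳ s2
      ≡⟨ cong (λ V → comp V ∷ʳ s2) (sym (Γd-∷ʳ W′ w)) ⟩
    comp (Γd (W′ ∷ʳ w)) ∷ʳ s2
      ∎
    where
    Z = rightEdge W′ (w ∷ flip w ∷ [])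
    lastFlipped : DifferAtEnd (w ∷ w ∷ []) (w ∷ flip w ∷ [])
    lastFlipped = w ∷ [] , ne w [] , w , refl , refl

  -- Γs on words ending in 1: the root w w̄ w is handled by rightEdge-alternating.
  Γs-∷ʳ-1 : ∀ W → Γs (W ∷ʳ s1) ≡ Γd (Γs (Γd W)) ∷ʳ s1
  Γs-∷ʳ-1 W with initLast W
  ... | [] = trans (Γs-∷ʳ [] s1)
                   (cong (_∷ʳ s1) (sym (trans (cong (Γd ∘ Γs) Γd-ε) (trans (cong Γd Γs-ε) Γd-ε))))
  ... | W′ ∷ʳ′ w = begin
    Γs ((W′ ∷ʳ w) ∷ʳ s1)
      ≡⟨ Γs-∷ʳ (W′ ∷ʳ w) s1 ⟩
    rightEdge (W′ ∷ʳ w) (s1 ∷ []) ∷ʳ s1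
      ≡⟨ cong (_∷ʳ s1) (rightEdge-∷ʳ W′ w (s1 ∷ [])) ⟩
    (rightEdge W′ (prim w (s1 ∷ [])) ∷ʳ lastLetter (prim w (s1 ∷ []))) ∷ʳ s1
      ≡⟨ cong (λ p → (rightEdge W′ p ∷ʳ lastLetter p) ∷ʳ s1) (prim-1 w) ⟩
    (rightEdge W′ (w ∷ flip w ∷ w ∷ []) ∷ʳ w) ∷ʳ s1
      ≡⟨ cong (λ V → (V ∷ʳ w) ∷ʳ s1) (rightEdge-alternating W′ w) ⟩
    (rightEdge M (flip w ∷ w ∷ []) ∷ʳ w) ∷ʳ s1
      ≡⟨ cong (_∷ʳ s1) (sym (Γd-∷ʳ-flip M w)) ⟩
    Γd (M ∷ʳ flip w) ∷ʳ s1
      ≡⟨ cong (λ V → Γd V ∷ʳ s1) (sym (Γs-∷ʳ Z (flip w))) ⟩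
    Γd (Γs (Z ∷ʳ flip w)) ∷ʳ s1
      ≡⟨ cong (λ V → Γd (Γs V) ∷ʳ s1) (sym (Γd-∷ʳ W′ w)) ⟩
    Γd (Γs (Γd (W′ ∷ʳ w))) ∷ʳ s1
      ∎
    where
    Z = rightEdge W′ (w ∷ flip w ∷ [])
    M = rightEdge Z (flip w ∷ [])

-- Theorem 4.  Statements (1) and (2) follow from (3) with X = 1, 2, the involutivity of Γd and the
-- formulas for Γs on words ending in 2 and 1; statement (4) is the involutivity of Γs.
theorem4 : (Γs Γd : Word → Word) → IsΓs Γs → IsΓd Γd → (U : Word) →
    (Γd (Γs (U ++ s1 ∷ [])) ≡ comp (Γd (Γs U)) ++ s2 ∷ [])
    × (Γd (Γs (U ++ s2 ∷ [])) ≡ Γd (Γs (Γd (Γs U))) ++ s1 ∷ [])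
    × (∀ X → Γs (U ++ X ∷ []) ≡ Γd (Γs (Γs U ++ flip X ∷ [])))
    × (Γd U ≡ Γd (Γs (Γs U)))
theorem4 Γs Γd isΓs isΓd U = statement1 , statement2 , Γs-∷ʳ-via-Γd U , cong Γd (sym (Γs-involutive U))
  where
  open Consequences Γs Γd (proj₁ isΓs) (proj₁ isΓd) (Γs-∷ʳ-formula Γs isΓs) (Γd-∷ʳ-formula Γd isΓd)
  open ≡-Reasoning
  statement1 : Γd (Γs (U ∷ʳ s1)) ≡ comp (Γd (Γs U)) ∷ʳ s2
  statement1 = begin
    Γd (Γs (U ∷ʳ s1))                ≡⟨ cong Γd (Γs-∷ʳ-via-Γd U s1) ⟩
    Γd (Γd (Γs (Γs U ∷ʳ s2)))        ≡⟨ Γd-involutive _ ⟩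
    Γs (Γs U ∷ʳ s2)                  ≡⟨ Γs-∷ʳ-2 (Γs U) ⟩
    comp (Γd (Γs U)) ∷ʳ s2           ∎
  statement2 : Γd (Γs (U ∷ʳ s2)) ≡ Γd (Γs (Γd (Γs U))) ∷ʳ s1
  statement2 = begin
    Γd (Γs (U ∷ʳ s2))                ≡⟨ cong Γd (Γs-∷ʳ-via-Γd U s2) ⟩
    Γd (Γd (Γs (Γs U ∷ʳ s1)))        ≡⟨ Γd-involutive _ ⟩
    Γs (Γs U ∷ʳ s1)                  ≡⟨ Γs-∷ʳ-1 (Γs U) ⟩
    Γd (Γs (Γd (Γs U))) ∷ʳ s1        ∎
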